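{- Let $p$ be a prime, $l,j$ positive integers and $a_1,\ldots,a_{l+1}$ positive integers. Write $a_i=A_ip^j+B_i$ with integers $A_i\geq0$ and $0\leq B_i<p^j$ for $1\leq i\leq l+1$. Then \[ C_p(l;a_1,\ldots,a_{l+1})\geq C_p(l;A_1,\ldots,A_{l+1})+C_p(l;B_1,\ldots,B_{l+1}). \]
   Context: For nonnegative integers $x_1,\ldots,x_{l+1}$, $C_p(l;x_1,\ldots,x_{l+1})$ denotes the number of carries in a parenthesized base-$p$ addition of $x_1,\ldots,x_{l+1}$: the sum is fully bracketed so that each pair of parentheses encloses exactly two summands, and one counts the total number of carries (positions where digit sum plus incoming carry is at least $p$) over all binary additions performed. This number is independent of the order and parenthesization and equals $v_p\big((x_1+\cdots+x_{l+1})!/(x_1!\cdots x_{l+1}!)\big)$. -}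

module Defs where

open import Data.Nat using (ℕ; zero; suc; _+_; _/_; _%_; _<ᵇ_; NonZero)
open import Data.Bool using (if_then_else_)
open import Data.Vec using (Vec; _∷_; []; foldl)

-- The fuel argument
-- only ensures termination; carries2 below supplies enough fuel
-- (each step halves-or-better x + y, and at most one extra step is needed
-- for a final carry).
carriesAux : (p : ℕ) → .{{NonZero p}} → ℕ → ℕ → ℕ → ℕ → ℕ
carriesAux p zero x y c = zero
carriesAux p (suc fuel) x y c =
  let d    = x % p + y % p + c
      cout = if d <ᵇ p then 0 else 1
  in cout + carriesAux p fuel (x / p) (y / p) cout

carries2 : (p : ℕ) → .{{NonZero p}} → ℕ → ℕ → ℕ
carries2 p x y = carriesAux p (suc (x + y)) x y 0

-- C_p(l; x_1, ..., x_{l+1}) : total number of carries in the parenthesized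
-- base-p addition ((x_1 + x_2) + x_3) + ... + x_{l+1}
-- (independent of parenthesization/order, per the paper).
Cp : (p : ℕ) → .{{NonZero p}} → (l : ℕ) → Vec ℕ (suc l) → ℕ
Cp p l (x ∷ xs) = go x xs
  where
  go : {n : ℕ} → ℕ → Vec ℕ n → ℕ
  go s [] = 0
  go s (y ∷ ys) = carries2 p s y + go (s + y) ys

-- Legendre's formula in carry form: if s is the base-p digit sum, then
-- (p − 1) · C_p(l; x) = Σ s(x_i) − s(Σ x_i).  For a_i = A_i p^j + B_i the digit
-- blocks of A_i and B_i do not overlap, so s(a_i) = s(A_i) + s(B_i) and the
-- sums Σ s(·) split exactly.  On the other side Σ a_i = (Σ A_i) p^j + Σ B_i
-- only gives s(Σ a_i) ≤ s(Σ A_i) + s(Σ B_i), by subadditivity of s (itself the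
-- two-term case of the formula).
module Submission where

open import Defs
open import Data.Nat using (ℕ; zero; suc; _≤_; _<_; _^_; _/_; _%_; _+_; _*_; _∸_; _<ᵇ_; z≤n; s≤s; NonZero)
open import Data.Nat.Primality using (Prime; prime⇒nonZero; ¬prime[0]; ¬prime[1])
open import Data.Nat.Properties
open import Data.Nat.DivMod
open import Data.Nat.Tactic.RingSolver using (solve-∀)
open import Data.Vec using (Vec; map; sum; _∷_; [])
open import Data.Vec.Relation.Unary.All using (All)
open import Data.Bool using (true; false; T; if_then_else_)
open import Data.Product using (_×_; _,_; ∃)
open import Data.Empty using (⊥-elim)
open import Function.Base using (_⟨_⟩_)
open import Relation.Binary.PropositionalEquality

-- The base is p = 2 + m, so that p − 1 = 1 + m is available without truncated subtraction.
module Base (m : ℕ) where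

  p : ℕ
  p = 2 + m

  p-1 : ℕ
  p-1 = 1 + m

  digitSumFuel : ℕ → ℕ → ℕ
  digitSumFuel zero    n = 0
  digitSumFuel (suc f) n = n % p + digitSumFuel f (n / p)

  digitSum : ℕ → ℕ
  digitSum n = digitSumFuel n n

  digitSumFuel-0 : ∀ f → digitSumFuel f 0 ≡ 0
  digitSumFuel-0 zero    = refl
  digitSumFuel-0 (suc f) = cong (digitSumFuel f) (0/n≡0 p) ⟨ trans ⟩ digitSumFuel-0 f

  n≤1+f⇒n/p≤f : ∀ n f → n ≤ suc f → n / p ≤ f
  n≤1+f⇒n/p≤f zero    f _  = z≤n
  n≤1+f⇒n/p≤f (suc n) f le = ≤-pred (≤-trans (m/n<m (suc n) p (s≤s (s≤s z≤n))) le)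

  digitSumFuel-stable : ∀ f g n → n ≤ f → n ≤ g → digitSumFuel f n ≡ digitSumFuel g n
  digitSumFuel-stable zero    zero    n     _   _   = refl
  digitSumFuel-stable zero    (suc g) .zero z≤n _   = sym (digitSumFuel-0 (suc g))
  digitSumFuel-stable (suc f) zero    .zero _   z≤n = digitSumFuel-0 (suc f)
  digitSumFuel-stable (suc f) (suc g) n     n≤f n≤g =
    cong (n % p +_) (digitSumFuel-stable f g (n / p) (n≤1+f⇒n/p≤f n f n≤f) (n≤1+f⇒n/p≤f n g n≤g))

  digitSum-step : ∀ n → digitSum n ≡ n % p + digitSum (n / p)
  digitSum-step n =
    digitSumFuel-stable n (suc n) n ≤-refl (n≤1+n n) ⟨ trans ⟩
    cong (n % p +_) (digitSumFuel-stable n (n / p) (n / p) (m/n≤m n p) ≤-refl)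

  [r+u*p]%p≡r : ∀ r u → r < p → (r + u * p) % p ≡ r
  [r+u*p]%p≡r r u r<p = [m+kn]%n≡m%n r u p ⟨ trans ⟩ m<n⇒m%n≡m r<p

  [r+u*p]/p≡u : ∀ r u → r < p → (r + u * p) / p ≡ u
  [r+u*p]/p≡u r u r<p = begin
    (r + u * p) / p    ≡⟨ +-distrib-/ r (u * p) (subst (_< p) r≡[r%p+up%p] r<p) ⟩
    r / p + u * p / p  ≡⟨ cong₂ _+_ (m<n⇒m/n≡0 r<p) (m*n/n≡m u p) ⟩
    u                  ∎
    where
    open ≡-Reasoning
    r≡[r%p+up%p] : r ≡ r % p + u * p % p
    r≡[r%p+up%p] = sym (cong₂ _+_ (m<n⇒m%n≡m r<p) (m*n%n≡0 u p) ⟨ trans ⟩ +-identityʳ r)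

  digitSum-digit : ∀ r u → r < p → digitSum (r + u * p) ≡ r + digitSum u
  digitSum-digit r u r<p =
    digitSum-step (r + u * p) ⟨ trans ⟩
    cong₂ (λ a b → a + digitSum b) ([r+u*p]%p≡r r u r<p) ([r+u*p]/p≡u r u r<p)

  digitSum-block : ∀ j q r → r < p ^ j → digitSum (r + q * p ^ j) ≡ digitSum q + digitSum r
  digitSum-block zero    q zero    _          = cong digitSum (*-identityʳ q) ⟨ trans ⟩ sym (+-identityʳ _)
  digitSum-block zero    q (suc r) (s≤s ())
  digitSum-block (suc j) q r       r<p^[1+j]  = begin
    digitSum (r + q * (p * p ^ j))                  ≡⟨ cong digitSum regroup ⟩
    digitSum (r % p + (r / p + q * p ^ j) * p)      ≡⟨ digitSum-digit (r % p) (r / p + q * p ^ j) (m%n<n r p) ⟩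
    r % p + digitSum (r / p + q * p ^ j)            ≡⟨ cong (r % p +_) (digitSum-block j q (r / p) r/p<p^j) ⟩
    r % p + (digitSum q + digitSum (r / p))         ≡⟨ +-comm-middle (r % p) (digitSum q) (digitSum (r / p)) ⟩
    digitSum q + (r % p + digitSum (r / p))         ≡⟨ cong (digitSum q +_) (digitSum-step r) ⟨
    digitSum q + digitSum r                         ∎
    where
    open ≡-Reasoning
    +-comm-middle : ∀ a b c → a + (b + c) ≡ b + (a + c)
    +-comm-middle = solve-∀
    regroup : r + q * (p * p ^ j) ≡ r % p + (r / p + q * p ^ j) * p
    regroup = cong (_+ q * (p * p ^ j)) (m≡m%n+[m/n]*n r p) ⟨ trans ⟩ ring (r % p) (r / p) q (p ^ j) p
      where
      ring : ∀ a b q P p → a + b * p + q * (p * P) ≡ a + (b + q * P) * p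
      ring = solve-∀
    r/p<p^j : r / p < p ^ j
    r/p<p^j = m<n*o⇒m/o<n (subst (r <_) (*-comm p (p ^ j)) r<p^[1+j])

  digits+carry<2p : ∀ x y c → c ≤ 1 → x % p + y % p + c < p + p
  digits+carry<2p x y c c≤1 =
    s≤s (≤-trans (+-mono-≤ (+-mono-≤ (≤-pred (m%n<n x p)) (≤-pred (m%n<n y p))) c≤1) (≤-reflexive (ring m)))
    where
    ring : ∀ m → suc m + suc m + 1 ≡ suc (m + suc (suc m))
    ring = solve-∀

  -- The carry-out bit is written exactly as in carriesAux, so that it matches there definitionally.
  digit-carry : ∀ d → d < p + p → ∃ λ r → r < p × d ≡ r + (if d <ᵇ p then 0 else 1) * p
  digit-carry d d<2p with d <ᵇ p in eq
  ... | true  = d , <ᵇ⇒< d p (subst T (sym eq) _) , sym (+-identityʳ d)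
  ... | false = d ∸ p , m<n+o⇒m∸n<o d p d<2p , sym (cong (d ∸ p +_) (+-identityʳ p) ⟨ trans ⟩ m∸n+n≡m p≤d)
    where
    p≤d : p ≤ d
    p≤d = ≮⇒≥ (λ d<p → subst T eq (<⇒<ᵇ d<p))

  carry≤1 : ∀ d → (if d <ᵇ p then 0 else 1) ≤ 1
  carry≤1 d with d <ᵇ p
  ... | true  = z≤n
  ... | false = ≤-refl

  +-by-digits : ∀ x y c r cout → x % p + y % p + c ≡ r + cout * p →
                x + y + c ≡ r + (x / p + y / p + cout) * p
  +-by-digits x y c r cout digits = begin
    x + y + c                                      ≡⟨ cong₂ (λ a b → a + b + c) (m≡m%n+[m/n]*n x p) (m≡m%n+[m/n]*n y p) ⟩
    (x % p + x / p * p) + (y % p + y / p * p) + c  ≡⟨ ring₁ (x % p) (x / p) (y % p) (y / p) c p ⟩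
    (x % p + y % p + c) + (x / p + y / p) * p      ≡⟨ cong (_+ (x / p + y / p) * p) digits ⟩
    (r + cout * p) + (x / p + y / p) * p           ≡⟨ ring₂ r cout (x / p) (y / p) p ⟩
    r + (x / p + y / p + cout) * p                 ∎
    where
    open ≡-Reasoning
    ring₁ : ∀ a b c d e q → (a + b * q) + (c + d * q) + e ≡ (a + c + e) + (b + d) * q
    ring₁ = solve-∀
    ring₂ : ∀ r c a b q → (r + c * q) + (a + b) * q ≡ r + (a + b + c) * q
    ring₂ = solve-∀

  r+q*p≤1+f⇒q≤f : ∀ r q f → r + q * p ≤ suc f → q ≤ f
  r+q*p≤1+f⇒q≤f r zero    f _  = z≤n
  r+q*p≤1+f⇒q≤f r (suc q) f le = ≤-pred (≤-trans 2+q≤r+[1+q]*p le)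
    where
    open ≤-Reasoning
    2+q≤r+[1+q]*p : suc (suc q) ≤ r + suc q * p
    2+q≤r+[1+q]*p = begin
      suc (suc q)            ≤⟨ s≤s (s≤s (m≤m*n q p)) ⟩
      suc (suc (q * p))      ≤⟨ s≤s (s≤s (m≤n+m (q * p) m)) ⟩
      p + q * p              ≤⟨ m≤n+m (p + q * p) r ⟩
      r + suc q * p          ∎

  carriesAux-digitSum : ∀ f x y c → c ≤ 1 → x + y + c ≤ f →
    carriesAux p f x y c * p-1 + digitSum (x + y + c) ≡ digitSum x + digitSum y + c
  carriesAux-digitSum zero    zero    zero    zero    _   _  = refl
  carriesAux-digitSum zero    (suc x) y       c       _   ()
  carriesAux-digitSum zero    zero    (suc y) c       _   ()
  carriesAux-digitSum zero    zero    zero    (suc c) _   ()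
  carriesAux-digitSum (suc f) x       y       c       c≤1 le
    with digit-carry (x % p + y % p + c) (digits+carry<2p x y c c≤1)
  ... | r , r<p , digits = begin
    (cout + C) * p-1 + digitSum (x + y + c)                   ≡⟨ cong (λ z → (cout + C) * p-1 + digitSum z) x+y+c≡ ⟩
    (cout + C) * p-1 + digitSum (r + q * p)                   ≡⟨ cong ((cout + C) * p-1 +_) (digitSum-digit r q r<p) ⟩
    (cout + C) * p-1 + (r + digitSum q)                       ≡⟨ ring₁ cout C r (digitSum q) p-1 ⟩
    cout * p-1 + r + (C * p-1 + digitSum q)                   ≡⟨ cong (cout * p-1 + r +_) ih ⟩
    cout * p-1 + r + (digitSum (x / p) + digitSum (y / p) + cout) ≡⟨ ring₂ cout r (digitSum (x / p)) (digitSum (y / p)) m ⟩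
    (r + cout * p) + digitSum (x / p) + digitSum (y / p)      ≡⟨ cong (λ z → z + digitSum (x / p) + digitSum (y / p)) digits ⟨
    (x % p + y % p + c) + digitSum (x / p) + digitSum (y / p) ≡⟨ ring₃ (x % p) (y % p) c (digitSum (x / p)) (digitSum (y / p)) ⟩
    (x % p + digitSum (x / p)) + (y % p + digitSum (y / p)) + c ≡⟨ cong₂ (λ a b → a + b + c) (digitSum-step x) (digitSum-step y) ⟨
    digitSum x + digitSum y + c                               ∎
    where
    open ≡-Reasoning
    cout = if x % p + y % p + c <ᵇ p then 0 else 1
    C    = carriesAux p f (x / p) (y / p) cout
    q    = x / p + y / p + cout
    x+y+c≡ : x + y + c ≡ r + q * p
    x+y+c≡ = +-by-digits x y c r cout digits
    ih : C * p-1 + digitSum q ≡ digitSum (x / p) + digitSum (y / p) + cout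
    ih = carriesAux-digitSum f (x / p) (y / p) cout (carry≤1 (x % p + y % p + c))
           (r+q*p≤1+f⇒q≤f r q f (subst (_≤ suc f) x+y+c≡ le))
    ring₁ : ∀ a b r s k → (a + b) * k + (r + s) ≡ a * k + r + (b * k + s)
    ring₁ = solve-∀
    ring₂ : ∀ a r s t m → a * suc m + r + (s + t + a) ≡ (r + a * suc (suc m)) + s + t
    ring₂ = solve-∀
    ring₃ : ∀ a b c s t → (a + b + c) + s + t ≡ (a + s) + (b + t) + c
    ring₃ = solve-∀

  carries2-digitSum : ∀ x y → carries2 p x y * p-1 + digitSum (x + y) ≡ digitSum x + digitSum y
  carries2-digitSum x y = begin
    carries2 p x y * p-1 + digitSum (x + y)      ≡⟨ cong (λ z → carries2 p x y * p-1 + digitSum z) (+-identityʳ (x + y)) ⟨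
    carries2 p x y * p-1 + digitSum (x + y + 0)  ≡⟨ carriesAux-digitSum (suc (x + y)) x y 0 z≤n x+y+0≤1+x+y ⟩
    digitSum x + digitSum y + 0                  ≡⟨ +-identityʳ _ ⟩
    digitSum x + digitSum y                      ∎
    where
    open ≡-Reasoning
    x+y+0≤1+x+y : x + y + 0 ≤ suc (x + y)
    x+y+0≤1+x+y = ≤-trans (≤-reflexive (+-identityʳ (x + y))) (n≤1+n (x + y))

  digitSum-+-≤ : ∀ x y → digitSum (x + y) ≤ digitSum x + digitSum y
  digitSum-+-≤ x y = subst (digitSum (x + y) ≤_) (carries2-digitSum x y) (m≤n+m _ (carries2 p x y * p-1))

  Cp-digitSum : ∀ l (v : Vec ℕ (suc l)) → Cp p l v * p-1 + digitSum (sum v) ≡ sum (map digitSum v)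
  Cp-digitSum zero    (x ∷ [])     = cong digitSum (+-identityʳ x) ⟨ trans ⟩ sym (+-identityʳ (digitSum x))
  Cp-digitSum (suc l) (x ∷ y ∷ ys) = begin
    (c + C) * p-1 + digitSum (x + (y + sum ys))              ≡⟨ cong (λ z → (c + C) * p-1 + digitSum z) (+-assoc x y (sum ys)) ⟨
    (c + C) * p-1 + digitSum (x + y + sum ys)                ≡⟨ ring c C p-1 (digitSum (x + y + sum ys)) ⟩
    c * p-1 + (C * p-1 + digitSum (x + y + sum ys))          ≡⟨ cong (c * p-1 +_) (Cp-digitSum l (x + y ∷ ys)) ⟩
    c * p-1 + (digitSum (x + y) + sum (map digitSum ys))     ≡⟨ +-assoc (c * p-1) _ _ ⟨
    c * p-1 + digitSum (x + y) + sum (map digitSum ys)       ≡⟨ cong (_+ sum (map digitSum ys)) (carries2-digitSum x y) ⟩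
    digitSum x + digitSum y + sum (map digitSum ys)          ≡⟨ +-assoc (digitSum x) _ _ ⟩
    digitSum x + (digitSum y + sum (map digitSum ys))        ∎
    where
    open ≡-Reasoning
    c = carries2 p x y
    C = Cp p l (x + y ∷ ys)
    ring : ∀ a b k s → (a + b) * k + s ≡ a * k + (b * k + s)
    ring = solve-∀

  module Blocks (j : ℕ) where

    P : ℕ
    P = p ^ j

    instance
      P≢0 : NonZero P
      P≢0 = m^n≢0 p j

    digitSum-divMod : ∀ x → digitSum x ≡ digitSum (x / P) + digitSum (x % P)
    digitSum-divMod x = cong digitSum (m≡m%n+[m/n]*n x P) ⟨ trans ⟩ digitSum-block j (x / P) (x % P) (m%n<n x P)

    sum-digitSum-divMod : ∀ {n} (a : Vec ℕ n) →
      sum (map digitSum a) ≡ sum (map digitSum (map (_/ P) a)) + sum (map digitSum (map (_% P) a))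
    sum-digitSum-divMod []      = refl
    sum-digitSum-divMod (x ∷ a) =
      cong₂ _+_ (digitSum-divMod x) (sum-digitSum-divMod a) ⟨ trans ⟩
      +-assoc-comm (digitSum (x / P)) (digitSum (x % P))
                   (sum (map digitSum (map (_/ P) a))) (sum (map digitSum (map (_% P) a)))
      where
      +-assoc-comm : ∀ a b c d → (a + b) + (c + d) ≡ (a + c) + (b + d)
      +-assoc-comm = solve-∀

    sum-divMod : ∀ {n} (a : Vec ℕ n) → sum a ≡ sum (map (_% P) a) + sum (map (_/ P) a) * P
    sum-divMod []      = refl
    sum-divMod (x ∷ a) = cong₂ _+_ (m≡m%n+[m/n]*n x P) (sum-divMod a) ⟨ trans ⟩
      ring (x % P) (x / P) (sum (map (_% P) a)) (sum (map (_/ P) a)) P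
      where
      ring : ∀ a b c d P → (a + b * P) + (c + d * P) ≡ (a + c) + (b + d) * P
      ring = solve-∀

    digitSum-sum-≤ : ∀ {n} (a : Vec ℕ n) →
      digitSum (sum a) ≤ digitSum (sum (map (_/ P) a)) + digitSum (sum (map (_% P) a))
    digitSum-sum-≤ a = begin
      digitSum (sum a)                  ≡⟨ cong digitSum (sum-divMod a) ⟩
      digitSum (ΣB + ΣA * P)            ≤⟨ digitSum-+-≤ ΣB (ΣA * P) ⟩
      digitSum ΣB + digitSum (ΣA * P)   ≡⟨ cong (digitSum ΣB +_) (digitSum-block j ΣA 0 (m^n>0 p j) ⟨ trans ⟩ +-identityʳ _) ⟩
      digitSum ΣB + digitSum ΣA         ≡⟨ +-comm (digitSum ΣB) (digitSum ΣA) ⟩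
      digitSum ΣA + digitSum ΣB         ∎
      where
      open ≤-Reasoning
      ΣA = sum (map (_/ P) a)
      ΣB = sum (map (_% P) a)

    Cp-divMod-≤ : ∀ l (a : Vec ℕ (suc l)) → Cp p l (map (_/ P) a) + Cp p l (map (_% P) a) ≤ Cp p l a
    Cp-divMod-≤ l a = *-cancelʳ-≤ _ _ p-1 (+-cancelʳ-≤ (digitSum (sum a)) _ _ scaled)
      where
      open ≤-Reasoning
      A = map (_/ P) a
      B = map (_% P) a
      ring : ∀ a b k x y → (a + b) * k + (x + y) ≡ (a * k + x) + (b * k + y)
      ring = solve-∀
      scaled : (Cp p l A + Cp p l B) * p-1 + digitSum (sum a) ≤ Cp p l a * p-1 + digitSum (sum a)
      scaled = begin
        (Cp p l A + Cp p l B) * p-1 + digitSum (sum a)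
          ≤⟨ +-monoʳ-≤ _ (digitSum-sum-≤ a) ⟩
        (Cp p l A + Cp p l B) * p-1 + (digitSum (sum A) + digitSum (sum B))
          ≡⟨ ring (Cp p l A) (Cp p l B) p-1 _ _ ⟩
        (Cp p l A * p-1 + digitSum (sum A)) + (Cp p l B * p-1 + digitSum (sum B))
          ≡⟨ cong₂ _+_ (Cp-digitSum l A) (Cp-digitSum l B) ⟩
        sum (map digitSum A) + sum (map digitSum B)
          ≡⟨ sum-digitSum-divMod a ⟨
        sum (map digitSum a)
          ≡⟨ Cp-digitSum l a ⟨
        Cp p l a * p-1 + digitSum (sum a)
          ∎

lemma7 : (p : ℕ) → (pp : Prime p) → (l j : ℕ) → 1 ≤ l → 1 ≤ j →
    (a : Vec ℕ (suc l)) → All (λ x → 1 ≤ x) a →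
    Cp p {{prime⇒nonZero pp}} l (map (λ x → _/_ x (p ^ j) {{m^n≢0 p j {{prime⇒nonZero pp}}}}) a)
      + Cp p {{prime⇒nonZero pp}} l (map (λ x → _%_ x (p ^ j) {{m^n≢0 p j {{prime⇒nonZero pp}}}}) a)
      ≤ Cp p {{prime⇒nonZero pp}} l a
lemma7 0               pp _ _ _ _ _ _ = ⊥-elim (¬prime[0] pp)
lemma7 1               pp _ _ _ _ _ _ = ⊥-elim (¬prime[1] pp)
lemma7 (suc (suc m)) _  l j _ _ a _ = Base.Blocks.Cp-divMod-≤ m j l a
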